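{- Let $p$ be a prime, $q=p^{r}$, $k\geq 3$ with $k\mid(q-1)$, $m=(q-1)/k$, $F=\mathrm{GF}(q)$, $\zeta$ a generator of $F^{*}$, $\varphi=\zeta^{m}$, $\Phi=\langle\varphi\rangle$ the subgroup of order $k$, and \[ s=\sum_{j=1}^{k-1}\bigl|(\Phi+1)\cap(\Phi+\varphi^{j})\bigr|. \] Suppose $(F,\Phi)$ is circular. Then $s=2k-3$ if $k$ is even; $s=2k-2$ if $p=2$; and $s=k-1$ if $p\neq 2$ and $k$ is odd.
   Context: The pair $(F,\Phi)$ is circular if $|\Phi a\cap(\Phi b+c)|\leq 2$ for all $a,b,c\in F^{*}$. -}

module Defs where

open import Level using (0ℓ)
open import Data.Nat as ℕ using (ℕ; zero; suc)
open import Data.Fin using (Fin)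
open import Data.Fin.Properties using () renaming (_≟_ to _≟F_)
open import Data.List using (List; []; _∷_; map; filter; length; upTo; applyUpTo)
open import Data.Nat.ListAction using (sum)
open import Data.List.Membership.DecPropositional using ()
open import Data.Fin.Base using ()
open import Data.List.Base using ()
open import Data.Product using (_×_; ∃)
open import Relation.Binary.PropositionalEquality using (_≡_; _≢_; cong; sym; trans)
open import Relation.Binary.Definitions using (DecidableEquality)
open import Relation.Nullary using (yes; no; _×-dec_)
open import Function.Bundles using (_↔_; Inverse)
open import Algebra.Structures using (IsCommutativeRing)
import Data.List.Membership.DecPropositional as DecMem
open import Data.Fin.Base using () renaming (_↑ˡ_ to _↑ˡ_)
import Data.List.Base as L

record FiniteField : Set₁ where
  infixl 7 _*_
  infixl 6 _+_
  field
    Carrier : Set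
    _+_ _*_ : Carrier → Carrier → Carrier
    -_ : Carrier → Carrier
    0# 1# : Carrier
    isCommutativeRing : IsCommutativeRing _≡_ _+_ _*_ -_ 0# 1#
    0≢1 : 0# ≢ 1#
    inverse : ∀ x → x ≢ 0# → ∃ λ y → x * y ≡ 1#
    size : ℕ
    enum : Carrier ↔ Fin size

  open Inverse enum using (to; from; strictlyInverseʳ)

  _≟_ : DecidableEquality Carrier
  x ≟ y with to x ≟F to y
  ... | yes e = yes (trans (sym (strictlyInverseʳ x))
                      (trans (cong from e) (strictlyInverseʳ y)))
  ... | no ne = no λ e → ne (cong to e)

  infixr 8 _^_
  _^_ : Carrier → ℕ → Carrier
  x ^ zero  = 1#
  x ^ suc n = x * x ^ n

  elements : List Carrier
  elements = L.map from (L.allFin size)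

  open DecMem _≟_ using (_∈?_) public

  ∣_∩_∣ : List Carrier → List Carrier → ℕ
  ∣ A ∩ B ∣ = length (filter (λ x → (x ∈? A) ×-dec (x ∈? B)) elements)

  IsGenerator : Carrier → Set
  IsGenerator ζ = ζ ≢ 0# × (∀ x → x ≢ 0# → ∃ λ n → ζ ^ n ≡ x)

  -- the subgroup Φ = ⟨φ⟩ = {φ^0, …, φ^(k-1)}, where k is the order of φ
  ⟨_⟩[_] : Carrier → ℕ → List Carrier
  ⟨ φ ⟩[ k ] = applyUpTo (φ ^_) k

  _+ₛ_ : List Carrier → Carrier → List Carrier
  A +ₛ c = L.map (_+ c) A

  _*ₛ_ : List Carrier → Carrier → List Carrier
  A *ₛ a = L.map (_* a) A

  Circular : List Carrier → Set
  Circular Φ = ∀ a b c → a ≢ 0# → b ≢ 0# → c ≢ 0# →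
               ∣ Φ *ₛ a ∩ ((Φ *ₛ b) +ₛ c) ∣ ℕ.≤ 2

  sumS : Carrier → ℕ → ℕ
  sumS φ k = sum (L.map (λ j → ∣ (⟨ φ ⟩[ k ] +ₛ 1#) ∩ (⟨ φ ⟩[ k ] +ₛ (φ ^ j)) ∣)
                        (applyUpTo suc (k ℕ.∸ 1)))

-- Put Φ = ⟨φ⟩ and fix 0 < j < k. The sets Φ + 1 and Φ + φʲ always share 1 + φʲ, and they
-- share 0 exactly when -1 ∈ Φ. They share nothing else: if x ≠ 0 lies in both, say
-- x = a + 1 = b + φʲ with a, b ∈ Φ, then x - Φ contains 1, a, φʲ and b, and unless x = 1 + φʲ
-- three of these are distinct points of Φ ∩ (x - Φ), contradicting circularity. So each
-- summand of s is 1 or 2, and it remains to see when -1 ∈ Φ and when 1 + φʲ = 0. In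
-- characteristic 2, -1 = 1 ∈ Φ and 1 + φʲ ≠ 0, so every summand is 2. For odd p, q - 1 is even,
-- so -1 = ζ^((q-1)/2) ≠ 1; then -1 ∈ Φ iff k is even, in which case -1 = φ^(k/2) and exactly
-- the summand j = k/2 drops to 1.
module Submission where

open import Level using (0ℓ)
import Data.Nat as ℕ
open ℕ using (ℕ; zero; suc; z≤n; s≤s)
import Data.Nat.Properties as ℕP
open import Data.Nat.Divisibility
  using (_∣_; quotient; divides; ∣-refl; ∣1⇒≡1; ∣m∣n⇒∣m+n; ∣m+n∣m⇒∣n; m∣m*n)
open import Data.Nat.DivMod using (_%_; _/_; m%n<n; m≡m%n+[m/n]*n)
open import Data.Nat.Primality using (Prime; prime[2]; prime⇒irreducible; euclidsLemma)
open import Data.Nat.ListAction using (sum)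
open import Data.Fin as Fin using (Fin; toℕ; fromℕ<; punchOut)
open import Data.Fin.Properties
  using (¬Fin0; pigeonhole; injective⇒≤; punchOut-injective; toℕ<n; toℕ-fromℕ<; suc-injective)
open import Data.List using (List; []; _∷_; map; length; applyUpTo)
open import Data.List.Properties using (length-applyUpTo)
open import Data.List.Membership.Propositional using (_∈_)
open import Data.List.Membership.Propositional.Properties
  using (∈-map⁺; ∈-map⁻; ∈-filter⁺; ∈-filter⁻; ∈-allFin; ∈-applyUpTo⁺; ∈-applyUpTo⁻)
open import Data.List.Relation.Binary.Subset.Propositional using (_⊆_)
open import Data.List.Relation.Unary.Any using (here; there)
open import Data.List.Relation.Unary.All as All using (All; []; _∷_)
open import Data.List.Relation.Unary.Unique.Propositional using (Unique; []; _∷_)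
import Data.List.Relation.Unary.Unique.Propositional.Properties as Unique
open import Data.Product using (∃; _×_; _,_; proj₁; proj₂)
open import Data.Sum using (_⊎_; inj₁; inj₂)
open import Data.Empty using (⊥; ⊥-elim)
open import Function using (_∘_)
open import Function.Bundles using (Injection; Inverse)
open import Function.Definitions using (Injective)
open import Function.Properties.Inverse using (↔⇒↣; ↔-sym)
open import Relation.Binary.Definitions using (tri<; tri≈; tri>)
open import Relation.Binary.PropositionalEquality
  using (_≡_; _≢_; refl; sym; trans; cong; cong₂; subst; ≢-sym; module ≡-Reasoning)
open import Relation.Nullary using (¬_; Dec; yes; no; contradiction)
open import Relation.Nullary.Decidable using (_×-dec_)
open import Algebra.Structures using (IsCommutativeRing)
open import Algebra.Bundles using (Ring)
import Algebra.Properties.Ring as RingProperties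
open import Defs

module _ where
  open import Data.Nat using (_+_; _*_; _∸_; _<_)
  open ≡-Reasoning

  even⇒double : ∀ {n} → 2 ∣ n → ∃ λ h → n ≡ h + h
  even⇒double (divides h refl) = h , trans (ℕP.*-comm h 2) (cong (h +_) (ℕP.+-identityʳ h))

  odd⇒suc-double : ∀ n → ¬ 2 ∣ n → ∃ λ t → n ≡ suc (2 * t)
  odd⇒suc-double zero          2∤0 = ⊥-elim (2∤0 (divides 0 refl))
  odd⇒suc-double (suc zero)    _   = 0 , refl
  odd⇒suc-double (suc (suc n)) 2∤n+2 with odd⇒suc-double n (2∤n+2 ∘ ∣m∣n⇒∣m+n ∣-refl)
  ... | t , refl = suc t , cong suc (sym (ℕP.*-suc 2 t))

  2∤1 : ¬ 2 ∣ 1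
  2∤1 2∣1 with ∣1⇒≡1 2∣1
  ... | ()

  even⇒pred-odd : ∀ {n} → 2 ∣ n → 0 < n → ¬ 2 ∣ n ∸ 1
  even⇒pred-odd {suc n} 2∣1+n _ 2∣n = 2∤1 (∣m+n∣m⇒∣n (subst (2 ∣_) (ℕP.+-comm 1 n) 2∣1+n) 2∣n)

  odd-prime : ∀ {p} → Prime p → p ≢ 2 → ¬ 2 ∣ p
  odd-prime p-prime p≢2 2∣p with prime⇒irreducible p-prime 2∣p
  ... | inj₁ ()
  ... | inj₂ 2≡p = p≢2 (sym 2≡p)

  odd-^ : ∀ {p} → ¬ 2 ∣ p → ∀ r → ¬ 2 ∣ p ℕ.^ r
  odd-^ 2∤p zero    = 2∤1
  odd-^ 2∤p (suc r) 2∣pʳ⁺¹ with euclidsLemma _ _ prime[2] 2∣pʳ⁺¹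
  ... | inj₁ 2∣p  = 2∤p 2∣p
  ... | inj₂ 2∣pʳ = odd-^ 2∤p r 2∣pʳ

  half-pos : ∀ {n} h → n ≡ h + h → 0 < n → 0 < h
  half-pos zero    refl ()
  half-pos (suc h) _    _ = s≤s z≤n

  *-pos⁻ˡ : ∀ m {n} → 0 < m * n → 0 < m
  *-pos⁻ˡ (suc m) _ = s≤s z≤n

  sum-map-const : ∀ {A : Set} (f : A → ℕ) {c} xs → (∀ {x} → x ∈ xs → f x ≡ c) →
                  sum (map f xs) ≡ length xs * c
  sum-map-const f []       _     = refl
  sum-map-const f (x ∷ xs) f≡c = cong₂ _+_ (f≡c (here refl)) (sum-map-const f xs (f≡c ∘ there))

  sum-map-dip : ∀ {A : Set} (f : A → ℕ) {c x₀} xs → Unique xs → x₀ ∈ xs → f x₀ ≡ c →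
                (∀ {x} → x ∈ xs → x ≢ x₀ → f x ≡ suc c) → suc (sum (map f xs)) ≡ length xs * suc c
  sum-map-dip f (x ∷ xs) (x∉xs ∷ _) (here refl) fx≡c f≡1+c = cong suc (cong₂ _+_ fx≡c
    (sum-map-const f xs λ y∈xs → f≡1+c (there y∈xs) (≢-sym (All.lookup x∉xs y∈xs))))
  sum-map-dip f {c} (x ∷ xs) (x∉xs ∷ xs-unique) (there x₀∈xs) fx₀≡c f≡1+c = begin
    suc (f x + S)      ≡⟨ cong (λ n → suc (n + S)) (f≡1+c (here refl) (All.lookup x∉xs x₀∈xs)) ⟩
    suc (suc c + S)    ≡⟨ sym (ℕP.+-suc (suc c) S) ⟩
    suc c + suc S      ≡⟨ cong (suc c +_) (sum-map-dip f xs xs-unique x₀∈xs fx₀≡c (f≡1+c ∘ there)) ⟩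
    suc c + length xs * suc c ∎
    where
    S : ℕ
    S = sum (map f xs)

  ∈-exponents⁺ : ∀ {j k} → 0 < j → j < k → j ∈ applyUpTo suc (k ∸ 1)
  ∈-exponents⁺ {suc i} _ j<k = ∈-applyUpTo⁺ suc (ℕP.pred-mono-< j<k)

  ∈-exponents⁻ : ∀ {j k} → j ∈ applyUpTo suc (k ∸ 1) → 0 < j × j < k
  ∈-exponents⁻ j∈ with ∈-applyUpTo⁻ suc j∈
  ... | i , i<k-1 , refl = s≤s z≤n , ℕP.pred-cancel-< i<k-1

  exponents-unique : ∀ n → Unique (applyUpTo suc n)
  exponents-unique n = Unique.applyUpTo⁺₁ suc n λ i<j _ → ℕP.<⇒≢ i<j ∘ ℕP.suc-injective

module _ {A : Set} where

  ∈-remove : ∀ {x : A} {ys} → x ∈ ys →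
             ∃ λ zs → length ys ≡ suc (length zs) × (∀ {z} → z ∈ ys → z ≢ x → z ∈ zs)
  ∈-remove {ys = y ∷ ys} (here refl) = ys , refl , λ
    { (here refl) z≢y → ⊥-elim (z≢y refl)
    ; (there z∈ys) _  → z∈ys }
  ∈-remove {ys = y ∷ ys} (there x∈ys) with ∈-remove x∈ys
  ... | zs , len , keep = y ∷ zs , cong suc len , λ
    { (here refl) _   → here refl
    ; (there z∈ys) z≢x → there (keep z∈ys z≢x) }

  unique⊆⇒length≤ : ∀ {xs ys : List A} → Unique xs → xs ⊆ ys → length xs ℕ.≤ length ys
  unique⊆⇒length≤ {[]}     _               _   = z≤n
  unique⊆⇒length≤ {x ∷ xs} (x∉xs ∷ xs-uniq) sub with ∈-remove (sub (here refl))
  ... | zs , len , keep rewrite len =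
    s≤s (unique⊆⇒length≤ xs-uniq λ z∈xs → keep (sub (there z∈xs)) (≢-sym (All.lookup x∉xs z∈xs)))

module FiniteFieldProperties (F : FiniteField) where
  open FiniteField F
  open IsCommutativeRing isCommutativeRing
    using ( +-identityˡ; +-identityʳ; +-assoc; +-comm; -‿inverseˡ; -‿inverseʳ
          ; *-identityˡ; *-identityʳ; *-assoc; *-comm; distribʳ; zeroˡ; zeroʳ; isRing)
  open ≡-Reasoning

  ring : Ring 0ℓ 0ℓ
  ring = record { isRing = isRing }

  open RingProperties ring using (-1*x≈-x; -‿involutive; -0#≈0#; +-inverseˡ-unique; +-inverseʳ-unique)

  -1²≡1 : (- 1#) ^ 2 ≡ 1#
  -1²≡1 = trans (cong (- 1# *_) (*-identityʳ (- 1#))) (trans (-1*x≈-x (- 1#)) (-‿involutive 1#))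

  -1≢0 : - 1# ≢ 0#
  -1≢0 -1≡0 = 0≢1 (sym (trans (sym (-‿involutive 1#)) (trans (cong -_ -1≡0) -0#≈0#)))

  *-cancelˡ : ∀ {a x y} → a ≢ 0# → a * x ≡ a * y → x ≡ y
  *-cancelˡ {a} {x} {y} a≢0 ax≡ay with inverse a a≢0
  ... | a⁻¹ , aa⁻¹≡1 = begin
    x              ≡⟨ cancel x ⟨
    a⁻¹ * (a * x)  ≡⟨ cong (a⁻¹ *_) ax≡ay ⟩
    a⁻¹ * (a * y)  ≡⟨ cancel y ⟩
    y              ∎
    where
    cancel : ∀ z → a⁻¹ * (a * z) ≡ z
    cancel z = begin
      a⁻¹ * (a * z)  ≡⟨ *-assoc a⁻¹ a z ⟨
      a⁻¹ * a * z    ≡⟨ cong (_* z) (trans (*-comm a⁻¹ a) aa⁻¹≡1) ⟩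
      1# * z         ≡⟨ *-identityˡ z ⟩
      z              ∎

  square≡1⇒≡-1 : ∀ {y} → y * y ≡ 1# → y ≢ 1# → y ≡ - 1#
  square≡1⇒≡-1 {y} y²≡1 y≢1 with (y + 1#) ≟ 0#
  ... | yes y+1≡0 = +-inverseˡ-unique y 1# y+1≡0
  ... | no  y+1≢0 = ⊥-elim (y≢1 (*-cancelˡ y+1≢0 (begin
    (y + 1#) * y        ≡⟨ distribʳ y y 1# ⟩
    y * y + 1# * y      ≡⟨ cong₂ _+_ y²≡1 (*-identityˡ y) ⟩
    1# + y              ≡⟨ +-comm 1# y ⟩
    y + 1#              ≡⟨ *-identityʳ (y + 1#) ⟨
    (y + 1#) * 1#       ∎)))

  ^-+ : ∀ x m n → x ^ (m ℕ.+ n) ≡ x ^ m * x ^ n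
  ^-+ x zero    n = sym (*-identityˡ (x ^ n))
  ^-+ x (suc m) n = trans (cong (x *_) (^-+ x m n)) (sym (*-assoc x (x ^ m) (x ^ n)))

  ^-* : ∀ x m n → x ^ (m ℕ.* n) ≡ (x ^ m) ^ n
  ^-* x m zero    rewrite ℕP.*-zeroʳ m = refl
  ^-* x m (suc n) rewrite ℕP.*-suc m n = trans (^-+ x m (m ℕ.* n)) (cong (x ^ m *_) (^-* x m n))

  1^ : ∀ n → 1# ^ n ≡ 1#
  1^ zero    = refl
  1^ (suc n) = trans (*-identityˡ (1# ^ n)) (1^ n)

  ^≢0 : ∀ {x} n → x ≢ 0# → x ^ n ≢ 0#
  ^≢0 zero    _   1≡0   = 0≢1 (sym 1≡0)
  ^≢0 (suc n) x≢0 xxⁿ≡0 = ^≢0 n x≢0 (*-cancelˡ x≢0 (trans xxⁿ≡0 (sym (zeroʳ _))))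

  ^-mod : ∀ {g n} .{{_ : ℕ.NonZero n}} → g ^ n ≡ 1# → ∀ t → g ^ t ≡ g ^ (t % n)
  ^-mod {g} {n} gⁿ≡1 t = begin
    g ^ t                              ≡⟨ cong (g ^_) (m≡m%n+[m/n]*n t n) ⟩
    g ^ (t % n ℕ.+ t / n ℕ.* n)        ≡⟨ ^-+ g (t % n) _ ⟩
    g ^ (t % n) * g ^ (t / n ℕ.* n)    ≡⟨ cong (λ e → g ^ (t % n) * g ^ e) (ℕP.*-comm (t / n) n) ⟩
    g ^ (t % n) * g ^ (n ℕ.* (t / n))  ≡⟨ cong (g ^ (t % n) *_) (^-* g n (t / n)) ⟩
    g ^ (t % n) * (g ^ n) ^ (t / n)    ≡⟨ cong (λ z → g ^ (t % n) * z ^ (t / n)) gⁿ≡1 ⟩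
    g ^ (t % n) * 1# ^ (t / n)         ≡⟨ cong (g ^ (t % n) *_) (1^ (t / n)) ⟩
    g ^ (t % n) * 1#                   ≡⟨ *-identityʳ _ ⟩
    g ^ (t % n)                        ∎

  ^-root : ∀ {g n} → g ^ n ≡ 1# → ∀ t → (g ^ t) ^ n ≡ 1#
  ^-root {g} {n} gⁿ≡1 t = begin
    (g ^ t) ^ n      ≡⟨ ^-* g t n ⟨
    g ^ (t ℕ.* n)    ≡⟨ cong (g ^_) (ℕP.*-comm t n) ⟩
    g ^ (n ℕ.* t)    ≡⟨ ^-* g n t ⟩
    (g ^ n) ^ t      ≡⟨ cong (_^ t) gⁿ≡1 ⟩
    1# ^ t           ≡⟨ 1^ t ⟩
    1#               ∎

  ^-diff≡1 : ∀ {g a b} → g ≢ 0# → a ℕ.≤ b → g ^ a ≡ g ^ b → g ^ (b ℕ.∸ a) ≡ 1#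
  ^-diff≡1 {g} {a} {b} g≢0 a≤b gᵃ≡gᵇ = sym (*-cancelˡ (^≢0 a g≢0) (begin
    g ^ a * 1#                ≡⟨ *-identityʳ _ ⟩
    g ^ a                     ≡⟨ gᵃ≡gᵇ ⟩
    g ^ b                     ≡⟨ cong (g ^_) (ℕP.m+[n∸m]≡n a≤b) ⟨
    g ^ (a ℕ.+ (b ℕ.∸ a))     ≡⟨ ^-+ g a (b ℕ.∸ a) ⟩
    g ^ a * g ^ (b ℕ.∸ a)     ∎))

  -1^odd : ∀ {n} → ¬ 2 ∣ n → (- 1#) ^ n ≡ - 1#
  -1^odd {n} n-odd with odd⇒suc-double n n-odd
  ... | t , refl = begin
    - 1# * (- 1#) ^ (2 ℕ.* t)    ≡⟨ cong (- 1# *_) (^-* (- 1#) 2 t) ⟩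
    - 1# * ((- 1#) ^ 2) ^ t      ≡⟨ cong (λ z → - 1# * z ^ t) -1²≡1 ⟩
    - 1# * 1# ^ t                ≡⟨ cong (- 1# *_) (1^ t) ⟩
    - 1# * 1#                    ≡⟨ *-identityʳ (- 1#) ⟩
    - 1#                         ∎

  record HasOrder (g : Carrier) (n : ℕ) : Set where
    field
      ^-order       : g ^ n ≡ 1#
      order-minimal : ∀ {i} → 0 ℕ.< i → g ^ i ≡ 1# → n ℕ.≤ i

  open HasOrder

  order⇒≢0 : ∀ {g n} → HasOrder g n → 0 ℕ.< n → g ≢ 0#
  order⇒≢0 {n = suc n} order _ refl = 0≢1 (trans (sym (zeroˡ _)) (^-order order))

  ^-distinct : ∀ {g n a b} → HasOrder g n → a ℕ.< b → b ℕ.< n → g ^ a ≢ g ^ b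
  ^-distinct {g} {n} {a} {b} order a<b b<n gᵃ≡gᵇ = ℕP.<⇒≱ (ℕP.≤-<-trans (ℕP.m∸n≤m b a) b<n)
    (order-minimal order (ℕP.m<n⇒0<n∸m a<b)
      (^-diff≡1 (order⇒≢0 order (ℕP.≤-<-trans z≤n b<n)) (ℕP.<⇒≤ a<b) gᵃ≡gᵇ))

  ^-injective : ∀ {g n i j} → HasOrder g n → i ℕ.< n → j ℕ.< n → g ^ i ≡ g ^ j → i ≡ j
  ^-injective {i = i} {j} order i<n j<n gⁱ≡gʲ with ℕP.<-cmp i j
  ... | tri≈ _ i≡j _ = i≡j
  ... | tri< i<j _ _ = ⊥-elim (^-distinct order i<j j<n gⁱ≡gʲ)
  ... | tri> _ _ j<i = ⊥-elim (^-distinct order j<i i<n (sym gⁱ≡gʲ))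

  ^-half≢1 : ∀ {g h} → HasOrder g (h ℕ.+ h) → 0 ℕ.< h → g ^ h ≢ 1#
  ^-half≢1 {h = h} order 0<h gʰ≡1 = ℕP.<⇒≱ (ℕP.m<m+n h 0<h) (order-minimal order 0<h gʰ≡1)

  ^-half≡-1 : ∀ {g h} → HasOrder g (h ℕ.+ h) → 0 ℕ.< h → g ^ h ≡ - 1#
  ^-half≡-1 {g} {h} order 0<h =
    square≡1⇒≡-1 (trans (sym (^-+ g h h)) (^-order order)) (^-half≢1 order 0<h)

  ^-order-of-power : ∀ {g m k} → HasOrder g (m ℕ.* k) → 0 ℕ.< m → HasOrder (g ^ m) k
  ^-order-of-power {g} {m} {k} order 0<m = record
    { ^-order       = trans (sym (^-* g m k)) (^-order order)
    ; order-minimal = λ {i} 0<i gᵐⁱ≡1 → ℕP.*-cancelˡ-≤ m {{ℕ.>-nonZero 0<m}}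
        (order-minimal order (ℕP.*-mono-< 0<m 0<i) (trans (^-* g m i) gᵐⁱ≡1))
    }

  ⟨⟩-*-closed : ∀ {g n x y} .{{_ : ℕ.NonZero n}} → g ^ n ≡ 1# →
                x ∈ ⟨ g ⟩[ n ] → y ∈ ⟨ g ⟩[ n ] → x * y ∈ ⟨ g ⟩[ n ]
  ⟨⟩-*-closed {g} {n} gⁿ≡1 x∈ y∈ with ∈-applyUpTo⁻ (g ^_) x∈ | ∈-applyUpTo⁻ (g ^_) y∈
  ... | i , _ , refl | j , _ , refl =
    subst (_∈ ⟨ g ⟩[ n ]) (trans (sym (^-mod gⁿ≡1 (i ℕ.+ j))) (^-+ g i j))
          (∈-applyUpTo⁺ (g ^_) (m%n<n (i ℕ.+ j) n))

  ⟨⟩-roots : ∀ {g n x} → g ^ n ≡ 1# → x ∈ ⟨ g ⟩[ n ] → x ^ n ≡ 1#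
  ⟨⟩-roots {g} {n} gⁿ≡1 x∈ with ∈-applyUpTo⁻ (g ^_) x∈
  ... | i , _ , refl = ^-root {g} {n} gⁿ≡1 i

  open Inverse enum using (to; from; strictlyInverseʳ)
  open Injection (↔⇒↣ enum) using () renaming (injective to to-injective)
  open Injection (↔⇒↣ (↔-sym enum)) using () renaming (injective to from-injective)

  1<size : 1 ℕ.< size
  1<size = injective⇒≤ {f = to ∘ 0-or-1} (0-or-1-injective ∘ to-injective)
    where
    0-or-1 : Fin 2 → Carrier
    0-or-1 Fin.zero    = 0#
    0-or-1 (Fin.suc _) = 1#
    0-or-1-injective : Injective _≡_ _≡_ 0-or-1
    0-or-1-injective {Fin.zero}           {Fin.zero}           _   = refl
    0-or-1-injective {Fin.zero}           {Fin.suc Fin.zero}   0≡1 = ⊥-elim (0≢1 0≡1)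
    0-or-1-injective {Fin.suc Fin.zero}   {Fin.zero}           1≡0 = ⊥-elim (0≢1 (sym 1≡0))
    0-or-1-injective {Fin.suc Fin.zero}   {Fin.suc Fin.zero}   _   = refl

  -- The size powers x⁰, …, x^(size-1) all avoid 0#, so two of them coincide.
  period-exists : ∀ {x} → x ≢ 0# → ∃ λ e → 0 ℕ.< e × e ℕ.< size × x ^ e ≡ 1#
  period-exists {x} x≢0 = within size to to-injective
    where
    within : ∀ s (t : Carrier → Fin s) → Injective _≡_ _≡_ t →
             ∃ λ e → 0 ℕ.< e × e ℕ.< s × x ^ e ≡ 1#
    within zero    t _ = ⊥-elim (¬Fin0 (t 0#))
    within (suc n) t t-injective =
      collision (pigeonhole (ℕP.n<1+n n) λ i → punchOut (avoids-0 (toℕ i)))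
      where
      avoids-0 : ∀ a → t 0# ≢ t (x ^ a)
      avoids-0 a t0≡txᵃ = ^≢0 a x≢0 (sym (t-injective t0≡txᵃ))
      collision : (∃ λ i → ∃ λ j → i Fin.< j ×
                     punchOut (avoids-0 (toℕ i)) ≡ punchOut (avoids-0 (toℕ j))) →
                  ∃ λ e → 0 ℕ.< e × e ℕ.< suc n × x ^ e ≡ 1#
      collision (i , j , i<j , same) =
        toℕ j ℕ.∸ toℕ i , ℕP.m<n⇒0<n∸m i<j , ℕP.≤-<-trans (ℕP.m∸n≤m (toℕ j) (toℕ i)) (toℕ<n j) ,
        ^-diff≡1 x≢0 (ℕP.<⇒≤ i<j)
          (t-injective (punchOut-injective (avoids-0 (toℕ i)) (avoids-0 (toℕ j)) same))

  -- If ζᵉ = 1 then x ↦ (log x mod e) is injective on the nonzero elements.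
  generator-period≥ : ∀ {ζ e} → IsGenerator ζ → 0 ℕ.< e → ζ ^ e ≡ 1# → size ℕ.≤ suc e
  generator-period≥ {ζ} {suc e} (_ , log) _ ζᵉ≡1 =
    injective⇒≤ {f = index ∘ from} (from-injective ∘ index-injective)
    where
    residue : ∀ {x} → x ≢ 0# → Fin (suc e)
    residue {x} x≢0 = fromℕ< (m%n<n (proj₁ (log x x≢0)) (suc e))

    index : Carrier → Fin (suc (suc e))
    index x with x ≟ 0#
    ... | yes _   = Fin.zero
    ... | no  x≢0 = Fin.suc (residue x≢0)

    residue-injective : ∀ {x y} (x≢0 : x ≢ 0#) (y≢0 : y ≢ 0#) → residue x≢0 ≡ residue y≢0 → x ≡ y
    residue-injective {x} {y} x≢0 y≢0 same with log x x≢0 | log y y≢0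
    ... | a , ζᵃ≡x | b , ζᵇ≡y = begin
      x                 ≡⟨ ζᵃ≡x ⟨
      ζ ^ a             ≡⟨ ^-mod ζᵉ≡1 a ⟩
      ζ ^ (a % suc e)   ≡⟨ cong (ζ ^_) a%≡b% ⟩
      ζ ^ (b % suc e)   ≡⟨ ^-mod ζᵉ≡1 b ⟨
      ζ ^ b             ≡⟨ ζᵇ≡y ⟩
      y                 ∎
      where
      a%≡b% : a % suc e ≡ b % suc e
      a%≡b% = trans (sym (toℕ-fromℕ< _)) (trans (cong toℕ same) (toℕ-fromℕ< _))

    index-injective : Injective _≡_ _≡_ index
    index-injective {x} {y} same with x ≟ 0# | y ≟ 0#
    ... | yes x≡0 | yes y≡0 = trans x≡0 (sym y≡0)
    ... | yes _   | no _    = contradiction same λ ()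
    ... | no _    | yes _   = contradiction same λ ()
    ... | no x≢0  | no y≢0  = residue-injective x≢0 y≢0 (suc-injective same)

  generator-order : ∀ {ζ} → IsGenerator ζ → HasOrder ζ (size ℕ.∸ 1)
  generator-order {ζ} generator@(ζ≢0 , _) with period-exists ζ≢0
  ... | e , 0<e , e<size , ζᵉ≡1 = record
    { ^-order       = subst (λ n → ζ ^ n ≡ 1#) e≡size-1 ζᵉ≡1
    ; order-minimal = λ 0<i ζⁱ≡1 → ℕP.∸-monoˡ-≤ 1 (generator-period≥ generator 0<i ζⁱ≡1)
    }
    where
    e≡size-1 : e ≡ size ℕ.∸ 1
    e≡size-1 = ℕP.≤-antisym (ℕP.∸-monoˡ-≤ 1 e<size)
                            (ℕP.∸-monoˡ-≤ 1 (generator-period≥ generator 0<e ζᵉ≡1))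

  generator-even⇒-1≢1 : ∀ {ζ} → IsGenerator ζ → 2 ∣ size ℕ.∸ 1 → - 1# ≢ 1#
  generator-even⇒-1≢1 {ζ} generator 2∣size-1 -1≡1 with even⇒double 2∣size-1
  ... | h , size-1≡h+h = ^-half≢1 order 0<h (trans (^-half≡-1 order 0<h) -1≡1)
    where
    order : HasOrder ζ (h ℕ.+ h)
    order = subst (HasOrder ζ) size-1≡h+h (generator-order generator)
    0<h : 0 ℕ.< h
    0<h = half-pos h size-1≡h+h (ℕP.m<n⇒0<n∸m 1<size)

  generator-odd⇒-1≡1 : ∀ {ζ} → IsGenerator ζ → ¬ 2 ∣ size ℕ.∸ 1 → - 1# ≡ 1#
  generator-odd⇒-1≡1 {ζ} generator@(_ , log) size-1-odd with log (- 1#) -1≢0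
  ... | t , ζᵗ≡-1 = begin
    - 1#                    ≡⟨ -1^odd size-1-odd ⟨
    (- 1#) ^ (size ℕ.∸ 1)   ≡⟨ cong (_^ (size ℕ.∸ 1)) ζᵗ≡-1 ⟨
    (ζ ^ t) ^ (size ℕ.∸ 1)  ≡⟨ ^-root {ζ} {size ℕ.∸ 1} (^-order (generator-order generator)) t ⟩
    1#                      ∎

  ∈-elements : ∀ x → x ∈ elements
  ∈-elements x = subst (_∈ elements) (strictlyInverseʳ x) (∈-map⁺ from (∈-allFin (to x)))

  elements-unique : Unique elements
  elements-unique = Unique.map⁺ from-injective (Unique.allFin⁺ size)

  module _ (A B : List Carrier) where
    private
      common? : ∀ x → Dec (x ∈ A × x ∈ B)
      common? x = (x ∈? A) ×-dec (x ∈? B)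

    ∣∩∣≥length : ∀ {zs} → Unique zs → All (λ z → z ∈ A × z ∈ B) zs → length zs ℕ.≤ ∣ A ∩ B ∣
    ∣∩∣≥length zs-unique zs-common = unique⊆⇒length≤ zs-unique
      λ z∈zs → ∈-filter⁺ common? (∈-elements _) (All.lookup zs-common z∈zs)

    ∣∩∣≡length : ∀ {zs} → Unique zs → All (λ z → z ∈ A × z ∈ B) zs →
                 (∀ {z} → z ∈ A → z ∈ B → z ∈ zs) → ∣ A ∩ B ∣ ≡ length zs
    ∣∩∣≡length zs-unique zs-common complete = ℕP.≤-antisym
      (unique⊆⇒length≤ (Unique.filter⁺ common? elements-unique)
        λ z∈ → let z∈A , z∈B = proj₂ (∈-filter⁻ common? {xs = elements} z∈) in complete z∈A z∈B)
      (∣∩∣≥length zs-unique zs-common)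

  ∈-translate : ∀ {Φ a c x} → a ∈ Φ → x ≡ a + c → x ∈ Φ +ₛ c
  ∈-translate a∈Φ refl = ∈-map⁺ _ a∈Φ

  ∈-dilation : ∀ {Φ a c x} → a ∈ Φ → x ≡ a * c → x ∈ Φ *ₛ c
  ∈-dilation a∈Φ refl = ∈-map⁺ _ a∈Φ

  module CircularTranslates {Φ : List Carrier} (circular : Circular Φ) (1∈Φ : 1# ∈ Φ) where

    reflection : Carrier → List Carrier
    reflection x = (Φ *ₛ (- 1#)) +ₛ x

    ∈-reflection : ∀ {v w x} → w ∈ Φ → x ≡ v + w → v ∈ reflection x
    ∈-reflection {v} {w} {x} w∈Φ x≡v+w = ∈-translate (∈-dilation w∈Φ refl) (begin
      v                   ≡⟨ +-identityˡ v ⟨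
      0# + v              ≡⟨ cong (_+ v) (-‿inverseˡ w) ⟨
      (- w + w) + v       ≡⟨ +-assoc (- w) w v ⟩
      - w + (w + v)       ≡⟨ cong₂ _+_ (-1*x≈-x w) (+-comm v w) ⟨
      - 1# * w + (v + w)  ≡⟨ cong₂ _+_ (*-comm (- 1#) w) (sym x≡v+w) ⟩
      w * - 1# + x        ∎)

    no-three-common : ∀ {x z₁ z₂ z₃} → x ≢ 0# → z₁ ≢ z₂ → z₁ ≢ z₃ → z₂ ≢ z₃ →
                      All (λ z → z ∈ Φ × z ∈ reflection x) (z₁ ∷ z₂ ∷ z₃ ∷ []) → ⊥
    no-three-common {x} x≢0 z₁≢z₂ z₁≢z₃ z₂≢z₃ common = ℕP.<-irrefl refl (ℕP.≤-trans
      (∣∩∣≥length (Φ *ₛ 1#) (reflection x) ((z₁≢z₂ ∷ z₁≢z₃ ∷ []) ∷ (z₂≢z₃ ∷ []) ∷ [] ∷ [])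
        (All.map (λ (z∈Φ , z∈x-Φ) → ∈-dilation z∈Φ (sym (*-identityʳ _)) , z∈x-Φ) common))
      (circular 1# (- 1#) x (0≢1 ∘ sym) -1≢0 x≢0))

    module _ {u : Carrier} (u∈Φ : u ∈ Φ) (u≢1 : u ≢ 1#) where

      nonzero-common : ∀ {x} → x ≢ 0# → x ∈ Φ +ₛ 1# → x ∈ Φ +ₛ u → x ≡ 1# + u
      nonzero-common {x} x≢0 x∈Φ+1 x∈Φ+u with x ≟ (1# + u)
      ... | yes x≡1+u = x≡1+u
      ... | no  x≢1+u with ∈-map⁻ (_+ 1#) x∈Φ+1 | ∈-map⁻ (_+ u) x∈Φ+u
      ... | a , a∈Φ , x≡a+1 | b , b∈Φ , x≡b+u = ⊥-elim (three-points (a ≟ 1#))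
        where
        1∈x-Φ : 1# ∈ reflection x
        1∈x-Φ = ∈-reflection a∈Φ (trans x≡a+1 (+-comm a 1#))
        u∈x-Φ : u ∈ reflection x
        u∈x-Φ = ∈-reflection b∈Φ (trans x≡b+u (+-comm b u))

        three-points : Dec (a ≡ 1#) → ⊥
        three-points (no a≢1) = no-three-common x≢0 (u≢1 ∘ sym) (a≢1 ∘ sym) u≢a
          ((1∈Φ , 1∈x-Φ) ∷ (u∈Φ , u∈x-Φ) ∷ (a∈Φ , ∈-reflection 1∈Φ x≡a+1) ∷ [])
          where
          u≢a : u ≢ a
          u≢a u≡a = x≢1+u (trans x≡a+1 (trans (cong (_+ 1#) (sym u≡a)) (+-comm u 1#)))
        three-points (yes a≡1) = no-three-common x≢0 (u≢1 ∘ sym) (b≢1 ∘ sym) u≢b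
          ((1∈Φ , 1∈x-Φ) ∷ (u∈Φ , u∈x-Φ) ∷ (b∈Φ , ∈-reflection u∈Φ x≡b+u) ∷ [])
          where
          x≡1+1 : x ≡ 1# + 1#
          x≡1+1 = trans x≡a+1 (cong (_+ 1#) a≡1)
          b≢1 : b ≢ 1#
          b≢1 b≡1 = x≢1+u (trans x≡b+u (cong (_+ u) b≡1))
          u≢b : u ≢ b
          u≢b u≡b = u≢1 (*-cancelˡ (x≢0 ∘ trans x≡1+1) (begin
            (1# + 1#) * u    ≡⟨ distribʳ u 1# 1# ⟩
            1# * u + 1# * u  ≡⟨ cong₂ _+_ (*-identityˡ u) (*-identityˡ u) ⟩
            u + u            ≡⟨ cong (_+ u) u≡b ⟩
            b + u            ≡⟨ trans (sym x≡b+u) x≡1+1 ⟩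
            1# + 1#          ≡⟨ *-identityʳ (1# + 1#) ⟨
            (1# + 1#) * 1#   ∎))

      common-translates : ∀ {z} → z ∈ Φ +ₛ 1# → z ∈ Φ +ₛ u → z ≡ 1# + u ⊎ z ≡ 0#
      common-translates {z} z∈Φ+1 z∈Φ+u with z ≟ 0#
      ... | yes z≡0 = inj₂ z≡0
      ... | no  z≢0 = inj₁ (nonzero-common z≢0 z∈Φ+1 z∈Φ+u)

      1+u∈translates : 1# + u ∈ Φ +ₛ 1# × 1# + u ∈ Φ +ₛ u
      1+u∈translates = ∈-translate u∈Φ (+-comm 1# u) , ∈-translate 1∈Φ refl

      -1∉Φ⇒∣∩∣≡1 : ¬ (- 1# ∈ Φ) → ∣ (Φ +ₛ 1#) ∩ (Φ +ₛ u) ∣ ≡ 1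
      -1∉Φ⇒∣∩∣≡1 -1∉Φ = ∣∩∣≡length _ _ ([] ∷ []) (1+u∈translates ∷ []) complete
        where
        complete : ∀ {z} → z ∈ Φ +ₛ 1# → z ∈ Φ +ₛ u → z ∈ 1# + u ∷ []
        complete z∈Φ+1 z∈Φ+u with common-translates z∈Φ+1 z∈Φ+u | ∈-map⁻ (_+ 1#) z∈Φ+1
        ... | inj₁ z≡1+u | _                 = here z≡1+u
        ... | inj₂ refl  | a , a∈Φ , 0≡a+1 =
          ⊥-elim (-1∉Φ (subst (_∈ Φ) (+-inverseˡ-unique a 1# (sym 0≡a+1)) a∈Φ))

      -1∈Φ⇒∣∩∣≡2 : - 1# ∈ Φ → - u ∈ Φ → 1# + u ≢ 0# → ∣ (Φ +ₛ 1#) ∩ (Φ +ₛ u) ∣ ≡ 2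
      -1∈Φ⇒∣∩∣≡2 -1∈Φ -u∈Φ 1+u≢0 = ∣∩∣≡length _ _ ((1+u≢0 ∷ []) ∷ [] ∷ [])
        (1+u∈translates ∷
          (∈-translate -1∈Φ (sym (-‿inverseˡ 1#)) , ∈-translate -u∈Φ (sym (-‿inverseˡ u))) ∷ [])
        complete
        where
        complete : ∀ {z} → z ∈ Φ +ₛ 1# → z ∈ Φ +ₛ u → z ∈ 1# + u ∷ 0# ∷ []
        complete z∈Φ+1 z∈Φ+u with common-translates z∈Φ+1 z∈Φ+u
        ... | inj₁ z≡1+u = here z≡1+u
        ... | inj₂ z≡0   = there (here z≡0)

      1+u≡0⇒∣∩∣≡1 : 1# + u ≡ 0# → ∣ (Φ +ₛ 1#) ∩ (Φ +ₛ u) ∣ ≡ 1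
      1+u≡0⇒∣∩∣≡1 1+u≡0 = ∣∩∣≡length _ _ ([] ∷ [])
        ((∈-translate u∈Φ (sym (trans (+-comm u 1#) 1+u≡0)) , ∈-translate 1∈Φ (sym 1+u≡0)) ∷ [])
        complete
        where
        complete : ∀ {z} → z ∈ Φ +ₛ 1# → z ∈ Φ +ₛ u → z ∈ 0# ∷ []
        complete z∈Φ+1 z∈Φ+u with common-translates z∈Φ+1 z∈Φ+u
        ... | inj₁ z≡1+u = here (trans z≡1+u 1+u≡0)
        ... | inj₂ z≡0   = here z≡0

  module SubgroupSums {φ k} (order : HasOrder φ k) (0<k : 0 ℕ.< k) (circular : Circular ⟨ φ ⟩[ k ]) where
    private instance
      k≢0 : ℕ.NonZero k
      k≢0 = ℕ.>-nonZero 0<k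

    Φ : List Carrier
    Φ = ⟨ φ ⟩[ k ]

    1∈Φ : 1# ∈ Φ
    1∈Φ = ∈-applyUpTo⁺ (φ ^_) 0<k

    open CircularTranslates circular 1∈Φ

    φʲ∈Φ : ∀ {j} → j ℕ.< k → φ ^ j ∈ Φ
    φʲ∈Φ = ∈-applyUpTo⁺ (φ ^_)

    φʲ≢1 : ∀ {j} → 0 ℕ.< j → j ℕ.< k → φ ^ j ≢ 1#
    φʲ≢1 0<j j<k = ^-distinct order 0<j j<k ∘ sym

    -‿∈Φ : ∀ {x} → - 1# ∈ Φ → x ∈ Φ → - x ∈ Φ
    -‿∈Φ {x} -1∈Φ x∈Φ = subst (_∈ Φ) (-1*x≈-x x) (⟨⟩-*-closed (^-order order) -1∈Φ x∈Φ)

    meet : ℕ → ℕ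
    meet j = ∣ (Φ +ₛ 1#) ∩ (Φ +ₛ (φ ^ j)) ∣

    exponents : List ℕ
    exponents = applyUpTo suc (k ℕ.∸ 1)

    sumS-const : ∀ {c} → (∀ {j} → 0 ℕ.< j → j ℕ.< k → meet j ≡ c) → sumS φ k ≡ (k ℕ.∸ 1) ℕ.* c
    sumS-const {c} meet≡c = trans
      (sum-map-const meet exponents λ j∈ → let 0<j , j<k = ∈-exponents⁻ {k = k} j∈ in meet≡c 0<j j<k)
      (cong (ℕ._* c) (length-applyUpTo suc (k ℕ.∸ 1)))

    sumS-odd : - 1# ≢ 1# → ¬ 2 ∣ k → sumS φ k ≡ k ℕ.∸ 1
    sumS-odd -1≢1 k-odd =
      trans (sumS-const λ 0<j j<k → -1∉Φ⇒∣∩∣≡1 (φʲ∈Φ j<k) (φʲ≢1 0<j j<k) -1∉Φ) (ℕP.*-identityʳ _)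
      where
      -1∉Φ : ¬ (- 1# ∈ Φ)
      -1∉Φ -1∈Φ = -1≢1 (trans (sym (-1^odd k-odd)) (⟨⟩-roots {φ} {k} (^-order order) -1∈Φ))

    sumS-char2 : - 1# ≡ 1# → sumS φ k ≡ 2 ℕ.* k ℕ.∸ 2
    sumS-char2 -1≡1 =
      trans (sumS-const meet≡2) (trans (ℕP.*-distribʳ-∸ 2 k 1) (cong (ℕ._∸ 2) (ℕP.*-comm k 2)))
      where
      -1∈Φ : - 1# ∈ Φ
      -1∈Φ = subst (_∈ Φ) (sym -1≡1) 1∈Φ
      meet≡2 : ∀ {j} → 0 ℕ.< j → j ℕ.< k → meet j ≡ 2
      meet≡2 0<j j<k = -1∈Φ⇒∣∩∣≡2 (φʲ∈Φ j<k) (φʲ≢1 0<j j<k) -1∈Φ (-‿∈Φ -1∈Φ (φʲ∈Φ j<k))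
        λ 1+φʲ≡0 → φʲ≢1 0<j j<k (trans (+-inverseʳ-unique 1# _ 1+φʲ≡0) -1≡1)

    sumS-even : 2 ∣ k → sumS φ k ≡ 2 ℕ.* k ℕ.∸ 3
    sumS-even 2∣k with even⇒double 2∣k
    ... | h , k≡h+h = begin
      sumS φ k                         ≡⟨ cong (ℕ._∸ 1) dip ⟩
      (k ℕ.∸ 1) ℕ.* 2 ℕ.∸ 1            ≡⟨ cong (ℕ._∸ 1) (ℕP.*-distribʳ-∸ 2 k 1) ⟩
      k ℕ.* 2 ℕ.∸ 2 ℕ.∸ 1              ≡⟨ ℕP.∸-+-assoc (k ℕ.* 2) 2 1 ⟩
      k ℕ.* 2 ℕ.∸ 3                    ≡⟨ cong (ℕ._∸ 3) (ℕP.*-comm k 2) ⟩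
      2 ℕ.* k ℕ.∸ 3                    ∎
      where
      0<h : 0 ℕ.< h
      0<h = half-pos h k≡h+h 0<k
      h<k : h ℕ.< k
      h<k = subst (h ℕ.<_) (sym k≡h+h) (ℕP.m<m+n h 0<h)
      φʰ≡-1 : φ ^ h ≡ - 1#
      φʰ≡-1 = ^-half≡-1 (subst (HasOrder φ) k≡h+h order) 0<h
      -1∈Φ : - 1# ∈ Φ
      -1∈Φ = subst (_∈ Φ) φʰ≡-1 (φʲ∈Φ h<k)
      meet≡2 : ∀ {j} → j ∈ exponents → j ≢ h → meet j ≡ 2
      meet≡2 {j} j∈ j≢h = -1∈Φ⇒∣∩∣≡2 (φʲ∈Φ j<k) (φʲ≢1 0<j j<k) -1∈Φ (-‿∈Φ -1∈Φ (φʲ∈Φ j<k))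
        λ 1+φʲ≡0 → j≢h (^-injective order j<k h<k (trans (+-inverseʳ-unique 1# _ 1+φʲ≡0) (sym φʰ≡-1)))
        where
        0<j : 0 ℕ.< j
        0<j = proj₁ (∈-exponents⁻ {k = k} j∈)
        j<k : j ℕ.< k
        j<k = proj₂ (∈-exponents⁻ {k = k} j∈)
      meet-h≡1 : meet h ≡ 1
      meet-h≡1 = 1+u≡0⇒∣∩∣≡1 (φʲ∈Φ h<k) (φʲ≢1 0<h h<k) (trans (cong (1# +_) φʰ≡-1) (-‿inverseʳ 1#))
      dip : suc (sumS φ k) ≡ (k ℕ.∸ 1) ℕ.* 2
      dip = trans
        (sum-map-dip meet exponents (exponents-unique _) (∈-exponents⁺ 0<h h<k) meet-h≡1 meet≡2)
        (cong (ℕ._* 2) (length-applyUpTo suc (k ℕ.∸ 1)))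

  size≡2^⇒-1≡1 : ∀ {ζ r} → IsGenerator ζ → size ≡ 2 ℕ.^ r → - 1# ≡ 1#
  size≡2^⇒-1≡1 {r = zero}  _         size≡1    = ⊥-elim (ℕP.<-irrefl (sym size≡1) 1<size)
  size≡2^⇒-1≡1 {r = suc r} generator size≡2ʳ⁺¹ = generator-odd⇒-1≡1 generator
    (even⇒pred-odd (subst (2 ∣_) (sym size≡2ʳ⁺¹) (m∣m*n (2 ℕ.^ r))) (ℕP.<-trans (s≤s z≤n) 1<size))

  size≡odd-prime^⇒-1≢1 : ∀ {ζ p r} → IsGenerator ζ → Prime p → p ≢ 2 → size ≡ p ℕ.^ r → - 1# ≢ 1#
  size≡odd-prime^⇒-1≢1 {p = p} {r} generator p-prime p≢2 size≡pʳ
    with odd⇒suc-double (p ℕ.^ r) (odd-^ (odd-prime p-prime p≢2) r)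
  ... | t , pʳ≡1+2t = generator-even⇒-1≢1 generator
    (divides t (trans (cong (ℕ._∸ 1) (trans size≡pʳ pʳ≡1+2t)) (ℕP.*-comm 2 t)))

open import Data.Nat using (_*_; _∸_; _^_; _≥_)

lemma20 : (p r k : ℕ) → Prime p → k ≥ 3 → (k∣ : k ∣ (p ^ r ∸ 1)) →
    (F : FiniteField) → FiniteField.size F ≡ p ^ r →
    (ζ : FiniteField.Carrier F) → FiniteField.IsGenerator F ζ →
    FiniteField.Circular F (FiniteField.⟨_⟩[_] F (FiniteField._^_ F ζ (quotient k∣)) k) →
      (2 ∣ k → FiniteField.sumS F (FiniteField._^_ F ζ (quotient k∣)) k ≡ 2 * k ∸ 3)
      × (p ≡ 2 → FiniteField.sumS F (FiniteField._^_ F ζ (quotient k∣)) k ≡ 2 * k ∸ 2)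
      × (p ≢ 2 → ¬ 2 ∣ k → FiniteField.sumS F (FiniteField._^_ F ζ (quotient k∣)) k ≡ k ∸ 1)
lemma20 p r k p-prime k≥3 k∣ F size≡pʳ ζ generator circular =
  sumS-even , (λ { refl → sumS-char2 (size≡2^⇒-1≡1 {r = r} generator size≡pʳ) }) ,
  λ p≢2 → sumS-odd (size≡odd-prime^⇒-1≢1 {r = r} generator p-prime p≢2 size≡pʳ)
  where
  open FiniteFieldProperties F
  m : ℕ
  m = quotient k∣
  size-1≡m*k : FiniteField.size F ∸ 1 ≡ m * k
  size-1≡m*k = trans (cong (_∸ 1) size≡pʳ) (_∣_.equality k∣)
  ζ-order : HasOrder ζ (m * k)
  ζ-order = subst (HasOrder ζ) size-1≡m*k (generator-order generator)
  0<m : 0 ℕ.< m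
  0<m = *-pos⁻ˡ m (subst (0 ℕ.<_) size-1≡m*k (ℕP.m<n⇒0<n∸m 1<size))
  open SubgroupSums (^-order-of-power ζ-order 0<m) (ℕP.≤-trans (s≤s z≤n) k≥3) circular
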